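{- Let $\mathcal{B}$ be an (abstract) Bar Code with $n$ rows on the column set $\{1,\dots,m\}$. Then $\mathcal{B}$ is admissible if and only if for every column $c\in\{1,\dots,m\}$, with e-list $e(c)=(b_{c,1},\dots,b_{c,n})$, and for every $k\in\{1,\dots,n\}$ with $b_{c,k}>0$, there exists a column $\bar c\neq c$ whose e-list is $e(\bar c)=(b_{c,1},\dots,b_{c,k-1},b_{c,k}-1,b_{c,k+1},\dots,b_{c,n})$.
   Context: An (abstract) Bar Code with $n$ rows on the column set $\{1,\dots,m\}$ is a sequence $R_1,\dots,R_n$ of partitions of $\{1,\dots,m\}$ into intervals of consecutive integers (the intervals of $R_i$ are called $i$-bars, numbered $B^{(i)}_1,\dots,B^{(i)}_{\mu(i)}$ from left to right), such that every $1$-bar is a single column and every $i$-bar ($i<n$) is contained in an $(i+1)$-bar. A bar of row $i'$ lies over a bar of row $i>i'$ if it is contained in it. The $1$-bar $\{c\}$ is identified with column $c$. The e-list of column $c$ is $e(c)=(b_{c,1},\dots,b_{c,n})$ where: $b_{c,n}$ is the number of $n$-bars strictly to the left of the $n$-bar containing $c$; and for $1\le i\le n-1$, $b_{c,i}$ is the number of $i$-bars contained in the $(i+1)$-bar containing $c$ that lie strictly to the left of the $i$-bar containing $c$. Let $x_1,\dots,x_n$ be variables; the set of terms associated to $\mathcal{B}$ is $\{x_1^{b_{c,1}}\cdots x_n^{b_{c,n}} : 1\le c\le m\}$. $\mathcal{B}$ is called admissible if this set of terms is an order ideal, i.e. closed under taking divisors. -}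

module Defs where

open import Data.Nat using (ℕ; zero; suc; _≤_; _<_; _≤ᵇ_; _<ᵇ_; _≡ᵇ_; _+_)
open import Data.Bool using (Bool; true; false; _∧_; if_then_else_)
open import Data.Product using (_×_; _,_; proj₁; proj₂; Σ; ∃-syntax)
open import Data.List using (List; []; _∷_)
open import Data.List.Membership.Propositional using (_∈_)
open import Data.Vec using (Vec; tabulate)
open import Data.Fin using (Fin; toℕ)
open import Relation.Binary.PropositionalEquality using (_≡_)

-- An interval of consecutive integers {lo, lo+1, ..., hi} (inclusive), as (lo , hi).
Interval : Set
Interval = ℕ × ℕ

lo hi : Interval → ℕ
lo = proj₁
hi = proj₂

Tiles : ℕ → ℕ → List Interval → Set
Tiles s m []      = s ≡ suc m
Tiles s m (B ∷ L) = (lo B ≡ s) × (lo B ≤ hi B) × Tiles (suc (hi B)) m L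

IntervalPartition : ℕ → List Interval → Set
IntervalPartition m L = Tiles 1 m L

_⊆I_ : Interval → Interval → Set
B ⊆I B' = (lo B' ≤ lo B) × (hi B ≤ hi B')

-- Abstract Bar Code with n rows on column set {1,...,m}.
-- rows i is the partition R_i (only rows 1..n are meaningful).
record BarCode (n m : ℕ) : Set where
  field
    rows       : ℕ → List Interval
    partition  : ∀ i → 1 ≤ i → i ≤ n → IntervalPartition m (rows i)
    row1single : ∀ B → B ∈ rows 1 → lo B ≡ hi B
    nested     : ∀ i → 1 ≤ i → i < n → ∀ B → B ∈ rows i →
                 ∃[ B' ] (B' ∈ rows (suc i) × B ⊆I B')
open BarCode public

_∈ᵇ_ : ℕ → Interval → Bool
c ∈ᵇ B = (lo B ≤ᵇ c) ∧ (c ≤ᵇ hi B)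

_⊆ᵇ_ : Interval → Interval → Bool
B ⊆ᵇ B' = (lo B' ≤ᵇ lo B) ∧ (hi B ≤ᵇ hi B')

_leftOfᵇ_ : Interval → Interval → Bool
B leftOfᵇ B' = hi B <ᵇ lo B'

barOf : ℕ → List Interval → Interval
barOf c []      = (0 , 0)
barOf c (B ∷ L) = if c ∈ᵇ B then B else barOf c L

count : (Interval → Bool) → List Interval → ℕ
count p []      = 0
count p (B ∷ L) = if p B then suc (count p L) else count p L

eEntry : ∀ {n m} → BarCode n m → ℕ → ℕ → ℕ
eEntry {n} 𝓑 c i =
  if i ≡ᵇ n
  then count (λ B → B leftOfᵇ barOf c (rows 𝓑 n)) (rows 𝓑 n)
  else count (λ B → (B ⊆ᵇ barOf c (rows 𝓑 (suc i))) ∧ (B leftOfᵇ barOf c (rows 𝓑 i)))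
             (rows 𝓑 i)

-- e-list e(c) = (b_{c,1},...,b_{c,n}); Fin index j stands for row toℕ j + 1.
-- It is also the exponent vector of the term x_1^{b_{c,1}} ⋯ x_n^{b_{c,n}}.
eList : ∀ {n m} → BarCode n m → ℕ → Vec ℕ n
eList {n} 𝓑 c = tabulate (λ (j : Fin n) → eEntry 𝓑 c (suc (toℕ j)))

Column : ℕ → ℕ → Set
Column m c = (1 ≤ c) × (c ≤ m)

-- divisibility of terms x^a ∣ x^b, i.e. componentwise a ≤ b on exponents
_∣ᵗ_ : ∀ {n} → Vec ℕ n → Vec ℕ n → Set
_∣ᵗ_ {n} a b = ∀ (k : Fin n) → Data.Vec.lookup a k ≤ Data.Vec.lookup b k

-- admissible: the set of terms {x^{e(c)} : 1 ≤ c ≤ m} is an order ideal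
Admissible : ∀ {n m} → BarCode n m → Set
Admissible {n} {m} 𝓑 =
  ∀ c → Column m c → ∀ (a : Vec ℕ n) → a ∣ᵗ eList 𝓑 c →
    ∃[ c' ] (Column m c' × eList 𝓑 c' ≡ a)

-- Nothing about Bar Codes is used: for any family of exponent vectors indexed by columns,
-- the set of terms is an order ideal iff it is closed under lowering one positive exponent
-- by 1. Forwards, the lowered vector divides the original one and differs from it, so it
-- comes from another column. Backwards, a proper divisor a of e(c) is strictly below it in
-- some coordinate k; lowering that coordinate gives the e-list of some column c̄, which a
-- still divides and whose exponent sum is smaller, so induction on the exponent sum finishes.
module Submission where

open import Defs
open import Data.Nat using (ℕ; _≤_; _<_; _∸_; z≤n; s≤s)
open import Data.Nat.Properties
  using (m∸n≤m; ≤-trans; ≤-reflexive; <-≤-trans; <-cmp; <-irrefl; ∸-monoˡ-≤; ∸-monoʳ-<; +-monoˡ-<; +-monoʳ-<)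
open import Data.Nat.Induction using (<-wellFounded)
open import Induction.WellFounded using (Acc; acc)
open import Data.Fin using (Fin; zero; suc; _≟_)
open import Data.Vec using (Vec; []; _∷_; lookup; _[_]≔_; sum)
open import Data.Vec.Properties using (lookup∘update; lookup∘update′)
open import Data.Product using (_×_; ∃-syntax; _,_)
open import Data.Sum using (_⊎_; inj₁; inj₂)
open import Relation.Binary using (tri<; tri≈; tri>)
open import Relation.Binary.PropositionalEquality using (_≡_; _≢_; refl; sym; trans; cong; subst)
open import Relation.Nullary using (yes; no; contradiction)
open import Function.Bundles using (_⇔_; mk⇔)

∣ᵗ⇒≡⊎∃< : ∀ {n} (a v : Vec ℕ n) → a ∣ᵗ v → a ≡ v ⊎ ∃[ k ] (lookup a k < lookup v k)
∣ᵗ⇒≡⊎∃< []       []       a∣v = inj₁ refl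
∣ᵗ⇒≡⊎∃< (x ∷ as) (y ∷ vs) a∣v with <-cmp x y
... | tri< x<y _ _ = inj₂ (zero , x<y)
... | tri> _ _ x>y = contradiction (<-≤-trans x>y (a∣v zero)) (<-irrefl refl)
... | tri≈ _ refl _ with ∣ᵗ⇒≡⊎∃< as vs (λ k → a∣v (suc k))
...   | inj₁ as≡vs       = inj₁ (cong (x ∷_) as≡vs)
...   | inj₂ (k , ak<vk) = inj₂ (suc k , ak<vk)

update-∣ᵗ : ∀ {n} (v : Vec ℕ n) (k : Fin n) {x : ℕ} → x ≤ lookup v k → (v [ k ]≔ x) ∣ᵗ v
update-∣ᵗ v k {x} x≤vk j with j ≟ k
... | yes refl = ≤-trans (≤-reflexive (lookup∘update j v x)) x≤vk
... | no j≢k   = ≤-reflexive (lookup∘update′ j≢k v x)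

∣ᵗ-update : ∀ {n} (a v : Vec ℕ n) (k : Fin n) {x : ℕ} →
            a ∣ᵗ v → lookup a k ≤ x → a ∣ᵗ (v [ k ]≔ x)
∣ᵗ-update a v k {x} a∣v ak≤x j with j ≟ k
... | yes refl = ≤-trans ak≤x (≤-reflexive (sym (lookup∘update j v x)))
... | no j≢k   = ≤-trans (a∣v j) (≤-reflexive (sym (lookup∘update′ j≢k v x)))

sum-update-< : ∀ {n} (v : Vec ℕ n) (k : Fin n) {x : ℕ} →
               x < lookup v k → sum (v [ k ]≔ x) < sum v
sum-update-< (y ∷ vs) zero    x<y  = +-monoˡ-< (sum vs) x<y
sum-update-< (y ∷ vs) (suc k) x<vk = +-monoʳ-< y (sum-update-< vs k x<vk)

decrement : ∀ {n} → Vec ℕ n → Fin n → Vec ℕ n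
decrement v k = v [ k ]≔ (lookup v k ∸ 1)

∸1-< : ∀ {x} → 0 < x → x ∸ 1 < x
∸1-< 0<x = ∸-monoʳ-< (s≤s z≤n) 0<x

decrement-≢ : ∀ {n} (v : Vec ℕ n) (k : Fin n) → 0 < lookup v k → decrement v k ≢ v
decrement-≢ v k 0<vk dec≡v = <-irrefl vk∸1≡vk (∸1-< 0<vk)
  where
  vk∸1≡vk : lookup v k ∸ 1 ≡ lookup v k
  vk∸1≡vk = trans (sym (lookup∘update k v _)) (cong (λ w → lookup w k) dec≡v)

module _ {n : ℕ} (Col : ℕ → Set) (f : ℕ → Vec ℕ n) where

  DownClosed : Set
  DownClosed = ∀ c → Col c → ∀ a → a ∣ᵗ f c → ∃[ c' ] (Col c' × f c' ≡ a)

  DecrementClosed : Set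
  DecrementClosed = ∀ c → Col c → ∀ k → 0 < lookup (f c) k →
                    ∃[ c̄ ] (Col c̄ × c̄ ≢ c × f c̄ ≡ decrement (f c) k)

  downClosed⇒decrementClosed : DownClosed → DecrementClosed
  downClosed⇒decrementClosed down c col k 0<fck
    with down c col (decrement (f c) k) (update-∣ᵗ (f c) k (m∸n≤m _ 1))
  ... | c̄ , col̄ , fc̄≡dec = c̄ , col̄ , c̄≢c , fc̄≡dec
    where
    c̄≢c : c̄ ≢ c
    c̄≢c refl = decrement-≢ (f c) k 0<fck (sym fc̄≡dec)

  decrementClosed⇒downClosed : DecrementClosed → DownClosed
  decrementClosed⇒downClosed closed c col = go c col (<-wellFounded (sum (f c)))
    where
    go : ∀ c → Col c → Acc _<_ (sum (f c)) → ∀ a → a ∣ᵗ f c → ∃[ c' ] (Col c' × f c' ≡ a)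
    go c col (acc rec) a a∣fc with ∣ᵗ⇒≡⊎∃< a (f c) a∣fc
    ... | inj₁ a≡fc = c , col , sym a≡fc
    ... | inj₂ (k , ak<fck) with closed c col k (≤-trans (s≤s z≤n) ak<fck)
    ...   | c̄ , col̄ , _ , fc̄≡dec = go c̄ col̄ (rec sum-fc̄<sum-fc) a a∣fc̄
      where
      sum-fc̄<sum-fc : sum (f c̄) < sum (f c)
      sum-fc̄<sum-fc = subst (λ w → sum w < sum (f c)) (sym fc̄≡dec)
                        (sum-update-< (f c) k (∸1-< (≤-trans (s≤s z≤n) ak<fck)))
      a∣fc̄ : a ∣ᵗ f c̄
      a∣fc̄ = subst (a ∣ᵗ_) (sym fc̄≡dec) (∣ᵗ-update a (f c) k a∣fc (∸-monoˡ-≤ 1 ak<fck))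

  downClosed⇔decrementClosed : DownClosed ⇔ DecrementClosed
  downClosed⇔decrementClosed = mk⇔ downClosed⇒decrementClosed decrementClosed⇒downClosed

mainTheorem1 : ∀ (n m : ℕ) → 1 ≤ n → (𝓑 : BarCode n m) →
    Admissible 𝓑 ⇔
      (∀ c → Column m c → ∀ (k : Fin n) → 0 < lookup (eList 𝓑 c) k →
        ∃[ c̄ ] (Column m c̄ × c̄ ≢ c ×
          eList 𝓑 c̄ ≡ (eList 𝓑 c [ k ]≔ (lookup (eList 𝓑 c) k ∸ 1))))
mainTheorem1 n m _ 𝓑 = downClosed⇔decrementClosed (Column m) (eList 𝓑)
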